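{- For $n\ge0$ let $\mathcal{D}_n(x)=\sum_{k=0}^n\binom{n}{k}k!\,(x-1)^{n-k}$ be the $n$-th derangement polynomial. Let $p\ge3$ be a prime, $s\ge1$ an integer and $m_0,\dots,m_s\in\{0,\dots,p-1\}$. Then $$\mathcal{D}_{m_0+m_1p+\cdots+m_sp^s}(x)\equiv\left(x^p-1\right)^{m_1}\left(x^{p^2}-1\right)^{m_2}\cdots\left(x^{p^s}-1\right)^{m_s}\mathcal{D}_{m_0}(x)\pmod p.$$ In particular, $$\mathcal{D}_{m_1p+\cdots+m_sp^s}(x)\equiv\left(x^p-1\right)^{m_1}\cdots\left(x^{p^s}-1\right)^{m_s}\pmod p,$$ and for every integer $k$, $\mathcal{D}_{m_1p+\cdots+m_sp^s}(k)\equiv(k-1)^{m_1+\cdots+m_s}\pmod p$.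
   Context: A congruence $P(x)\equiv Q(x)\pmod p$ between polynomials with integer coefficients means that every coefficient of $P(x)-Q(x)$ is divisible by $p$. -}

module Defs where

open import Data.Nat as ℕ using (ℕ; zero; suc)
open import Data.Nat.Combinatorics using (_C_)
open import Data.Nat using (_!)
open import Data.Integer as ℤ using (ℤ; +_; -[1+_])
open import Data.Integer.Divisibility using (_∣_)
open import Data.List using (List; []; _∷_; map; foldr; upTo; replicate; _++_)
open import Data.Fin using (Fin; toℕ)
import Data.Fin as Fin

-- Polynomials with integer coefficients, as coefficient lists
-- (constant term first). Trailing zeros are allowed; all notions
-- below (coefficients, congruence, evaluation) are insensitive to them.
Poly : Set
Poly = List ℤ

_⊕_ : Poly → Poly → Poly
[] ⊕ q = q
(a ∷ p) ⊕ [] = a ∷ p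
(a ∷ p) ⊕ (b ∷ q) = (a ℤ.+ b) ∷ (p ⊕ q)

infixl 6 _⊕_
infixl 7 _⊗_

scale : ℤ → Poly → Poly
scale c p = map (c ℤ.*_) p

_⊗_ : Poly → Poly → Poly
[] ⊗ q = []
(a ∷ p) ⊗ q = scale a q ⊕ (+ 0 ∷ (p ⊗ q))

const : ℤ → Poly
const c = c ∷ []

one : Poly
one = const (+ 1)

_^ᵖ_ : Poly → ℕ → Poly
p ^ᵖ zero = one
p ^ᵖ suc n = p ⊗ (p ^ᵖ n)

monomial : ℕ → Poly
monomial n = replicate n (+ 0) ++ (+ 1 ∷ [])

xpow-1 : ℕ → Poly
xpow-1 n = monomial n ⊕ const (-[1+ 0 ])

x-1 : Poly
x-1 = xpow-1 1

derangement : ℕ → Poly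
derangement n =
  foldr _⊕_ [] (map (λ k → const (+ ((n C k) ℕ.* (k !))) ⊗ (x-1 ^ᵖ (n ℕ.∸ k))) (upTo (suc n)))

coeff : Poly → ℕ → ℤ
coeff [] i = + 0
coeff (a ∷ p) zero = a
coeff (a ∷ p) (suc i) = coeff p i

_≡ₚ_[mod_] : Poly → Poly → ℕ → Set
P ≡ₚ Q [mod p ] = ∀ i → (+ p) ∣ (coeff P i ℤ.- coeff Q i)

_≡ᵢ_[mod_] : ℤ → ℤ → ℕ → Set
a ≡ᵢ b [mod p ] = (+ p) ∣ (a ℤ.- b)

eval : Poly → ℤ → ℤ
eval P k = foldr (λ a acc → a ℤ.+ k ℤ.* acc) (+ 0) P

sumFin : ∀ {n} → (Fin n → ℕ) → ℕ
sumFin {zero} f = 0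
sumFin {suc n} f = f Fin.zero ℕ.+ sumFin (λ i → f (Fin.suc i))

prodFin : ∀ {n} → (Fin n → Poly) → Poly
prodFin {zero} f = one
prodFin {suc n} f = f Fin.zero ⊗ prodFin (λ i → f (Fin.suc i))

{-# OPTIONS --safe #-}

-- Over ℤ the derangement polynomials satisfy D (n + 1) = (x - 1) ^ (n + 1) + (n + 1) D n. Modulo p
-- the coefficient n + 1 only depends on n mod p, so D (n + p) ≡ (x - 1) ^ p D n, and therefore
-- D (K + n) ≡ (x - 1) ^ K D n whenever p ∣ K. In characteristic p the Frobenius map is additive,
-- so (x - 1) ^ (p ^ j) ≡ x ^ (p ^ j) - 1, and splitting K = Σ m_j p ^ j gives the product formula.
-- Evaluating at k and using Fermat's little theorem, (k - 1) ^ (p ^ j) ≡ k - 1, gives the last part.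
module Submission where

open import Algebra.Bundles using (CommutativeRing)
open import Data.Nat using (ℕ)
open import Data.Nat.Primality using (Prime)

module Quotient where

  open import Algebra.Definitions using (Congruent₁; Congruent₂)
  open import Data.Product using (_,_)
  open import Relation.Binary.Core using (Rel; _⇒_)
  open import Relation.Binary.Structures using (IsEquivalence)

  module _ {a ℓ} (R : CommutativeRing a ℓ) where

    open CommutativeRing R

    quotientCommutativeRing : ∀ {ℓ′} (_∼_ : Rel Carrier ℓ′) →
      IsEquivalence _∼_ → _≈_ ⇒ _∼_ →
      Congruent₂ _∼_ _+_ → Congruent₂ _∼_ _*_ → Congruent₁ _∼_ (-_) →
      CommutativeRing a ℓ′
    quotientCommutativeRing _∼_ isEquivalence ≈⇒∼ +-cong∼ *-cong∼ -‿cong∼ = record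
      { isCommutativeRing = record
        { isRing = record
          { +-isAbelianGroup = record
            { isGroup = record
              { isMonoid = record
                { isSemigroup = record
                  { isMagma = record { isEquivalence = isEquivalence ; ∙-cong = +-cong∼ }
                  ; assoc = λ x y z → ≈⇒∼ (+-assoc x y z) }
                ; identity = (λ x → ≈⇒∼ (+-identityˡ x)) , (λ x → ≈⇒∼ (+-identityʳ x)) }
              ; inverse = (λ x → ≈⇒∼ (-‿inverseˡ x)) , (λ x → ≈⇒∼ (-‿inverseʳ x))
              ; ⁻¹-cong = -‿cong∼ }
            ; comm = λ x y → ≈⇒∼ (+-comm x y) }
          ; *-cong = *-cong∼
          ; *-assoc = λ x y z → ≈⇒∼ (*-assoc x y z)
          ; *-identity = (λ x → ≈⇒∼ (*-identityˡ x)) , (λ x → ≈⇒∼ (*-identityʳ x))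
          ; distrib = (λ x y z → ≈⇒∼ (distribˡ x y z)) , (λ x y z → ≈⇒∼ (distribʳ x y z)) }
        ; *-comm = λ x y → ≈⇒∼ (*-comm x y) } }


module IntegersModulo (n : ℕ) where

  import Data.Nat as ℕ
  open import Data.Integer using (ℤ; +_; 0ℤ; _+_; _*_; _-_; -_)
  open import Data.Integer.Divisibility.Signed
  open import Data.Integer.Properties using (+-*-commutativeRing; +-inverseʳ; *-zeroʳ)
  open import Data.Integer.Solver using (module +-*-Solver)
  open import Relation.Binary.PropositionalEquality using (_≡_; refl; sym; subst)
  open import Relation.Binary.Structures using (IsEquivalence)
  open +-*-Solver
  open Quotient

  infix 4 _≡ₘ_

  record _≡ₘ_ (a b : ℤ) : Set where
    constructor mod
    field n∣a-b : + n ∣ a - b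

  open _≡ₘ_ public

  private
    n∣0 : + n ∣ 0ℤ
    n∣0 = subst (+ n ∣_) (*-zeroʳ (+ n)) (∣m⇒∣m*n 0ℤ ∣-refl)

    n∣-resp : ∀ {x y} → x ≡ y → + n ∣ x → + n ∣ y
    n∣-resp = subst (+ n ∣_)

  ≡⇒≡ₘ : ∀ {a b} → a ≡ b → a ≡ₘ b
  ≡⇒≡ₘ {a} refl = mod (n∣-resp (sym (+-inverseʳ a)) n∣0)

  ≡ₘ-sym : ∀ {a b} → a ≡ₘ b → b ≡ₘ a
  ≡ₘ-sym {a} {b} (mod d) =
    mod (n∣-resp (solve 2 (λ a b → :- (a :- b) := b :- a) refl a b) (∣m⇒∣-m d))

  ≡ₘ-trans : ∀ {a b c} → a ≡ₘ b → b ≡ₘ c → a ≡ₘ c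
  ≡ₘ-trans {a} {b} {c} (mod d) (mod e) =
    mod (n∣-resp (solve 3 (λ a b c → (a :- b) :+ (b :- c) := a :- c) refl a b c) (∣m∣n⇒∣m+n d e))

  ≡ₘ-isEquivalence : IsEquivalence _≡ₘ_
  ≡ₘ-isEquivalence = record { refl = ≡⇒≡ₘ refl ; sym = ≡ₘ-sym ; trans = ≡ₘ-trans }

  +-cong-≡ₘ : ∀ {x x′ y y′} → x ≡ₘ x′ → y ≡ₘ y′ → x + y ≡ₘ x′ + y′
  +-cong-≡ₘ {x} {x′} {y} {y′} (mod d) (mod e) = mod (n∣-resp difference (∣m∣n⇒∣m+n d e))
    where
    difference : (x - x′) + (y - y′) ≡ (x + y) - (x′ + y′)
    difference =
      solve 4 (λ x x′ y y′ → (x :- x′) :+ (y :- y′) := (x :+ y) :- (x′ :+ y′)) refl x x′ y y′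

  *-cong-≡ₘ : ∀ {x x′ y y′} → x ≡ₘ x′ → y ≡ₘ y′ → x * y ≡ₘ x′ * y′
  *-cong-≡ₘ {x} {x′} {y} {y′} (mod d) (mod e) =
    mod (n∣-resp difference (∣m∣n⇒∣m+n (∣m⇒∣m*n y d) (∣n⇒∣m*n x′ e)))
    where
    difference : (x - x′) * y + x′ * (y - y′) ≡ x * y - x′ * y′
    difference =
      solve 4 (λ x x′ y y′ → (x :- x′) :* y :+ x′ :* (y :- y′) := x :* y :- x′ :* y′) refl x x′ y y′

  -‿cong-≡ₘ : ∀ {x x′} → x ≡ₘ x′ → - x ≡ₘ - x′
  -‿cong-≡ₘ {x} {x′} (mod d) =
    mod (n∣-resp (solve 2 (λ x x′ → :- (x :- x′) := (:- x) :- (:- x′)) refl x x′) (∣m⇒∣-m d))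

  +[m+n]≡ₘ+m : ∀ m → + (m ℕ.+ n) ≡ₘ + m
  +[m+n]≡ₘ+m m = mod (n∣-resp (solve 2 (λ m n → n := (m :+ n) :- m) refl (+ m) (+ n)) ∣-refl)

  ℤmod : CommutativeRing _ _
  ℤmod = quotientCommutativeRing +-*-commutativeRing _≡ₘ_ ≡ₘ-isEquivalence ≡⇒≡ₘ
    +-cong-≡ₘ *-cong-≡ₘ -‿cong-≡ₘ


module PolynomialArithmetic where

  open import Defs
  open import Algebra.Definitions using (Congruent₂)
  open import Data.Integer using (ℤ; +_; _+_; _*_)
  import Data.Integer.Properties as ℤ
  open import Data.Integer.Solver using (module +-*-Solver)
  open import Data.List using ([]; _∷_)
  open import Data.Nat using (zero; suc)
  import Data.Nat as ℕ
  open import Function using (_∘_)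
  open import Relation.Binary.Core using (Rel)
  open import Relation.Binary.PropositionalEquality
  open +-*-Solver
  open ≡-Reasoning

  coeff-⊕ : ∀ P Q i → coeff (P ⊕ Q) i ≡ coeff P i + coeff Q i
  coeff-⊕ [] Q i = sym (ℤ.+-identityˡ _)
  coeff-⊕ (a ∷ P) [] i = sym (ℤ.+-identityʳ _)
  coeff-⊕ (a ∷ P) (b ∷ Q) zero = refl
  coeff-⊕ (a ∷ P) (b ∷ Q) (suc i) = coeff-⊕ P Q i

  coeff-scale : ∀ c P i → coeff (scale c P) i ≡ c * coeff P i
  coeff-scale c [] i = sym (ℤ.*-zeroʳ c)
  coeff-scale c (a ∷ P) zero = refl
  coeff-scale c (a ∷ P) (suc i) = coeff-scale c P i

  -- convolution f g i = Σ_{j + k = i} f j * g k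
  convolution : (ℕ → ℤ) → (ℕ → ℤ) → ℕ → ℤ
  convolution f g zero = f 0 * g 0
  convolution f g (suc i) = f 0 * g (suc i) + convolution (f ∘ suc) g i

  convolution-cong : ∀ {ℓ} (_∼_ : Rel ℤ ℓ) → Congruent₂ _∼_ _+_ → Congruent₂ _∼_ _*_ →
    ∀ {f f′ g g′} → (∀ j → f j ∼ f′ j) → (∀ j → g j ∼ g′ j) →
    ∀ i → convolution f g i ∼ convolution f′ g′ i
  convolution-cong _∼_ +-cong *-cong f∼f′ g∼g′ zero = *-cong (f∼f′ 0) (g∼g′ 0)
  convolution-cong _∼_ +-cong *-cong f∼f′ g∼g′ (suc i) =
    +-cong (*-cong (f∼f′ 0) (g∼g′ (suc i)))
           (convolution-cong _∼_ +-cong *-cong (f∼f′ ∘ suc) g∼g′ i)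

  convolution-zeroˡ : ∀ g i → convolution (λ _ → + 0) g i ≡ + 0
  convolution-zeroˡ g zero = refl
  convolution-zeroˡ g (suc i) = cong (_+_ (+ 0 * g (suc i))) (convolution-zeroˡ g i)

  convolution-zeroʳ : ∀ f i → convolution f (λ _ → + 0) i ≡ + 0
  convolution-zeroʳ f zero = ℤ.*-zeroʳ (f 0)
  convolution-zeroʳ f (suc i) = cong₂ _+_ (ℤ.*-zeroʳ (f 0)) (convolution-zeroʳ (f ∘ suc) i)

  convolution-distribʳ : ∀ f f′ g i →
    convolution (λ j → f j + f′ j) g i ≡ convolution f g i + convolution f′ g i
  convolution-distribʳ f f′ g zero = ℤ.*-distribʳ-+ (g 0) (f 0) (f′ 0)
  convolution-distribʳ f f′ g (suc i) = begin
    (f 0 + f′ 0) * g (suc i) + convolution (λ j → f (suc j) + f′ (suc j)) g i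
      ≡⟨ cong (_+_ ((f 0 + f′ 0) * g (suc i))) (convolution-distribʳ (f ∘ suc) (f′ ∘ suc) g i) ⟩
    (f 0 + f′ 0) * g (suc i) + (convolution (f ∘ suc) g i + convolution (f′ ∘ suc) g i)
      ≡⟨ solve 5 (λ a b c x y → (a :+ b) :* c :+ (x :+ y) := (a :* c :+ x) :+ (b :* c :+ y)) refl
               (f 0) (f′ 0) (g (suc i)) (convolution (f ∘ suc) g i) (convolution (f′ ∘ suc) g i) ⟩
    convolution f g (suc i) + convolution f′ g (suc i) ∎

  coeff-∷-⊗ : ∀ a P Q i → coeff ((a ∷ P) ⊗ Q) i ≡ a * coeff Q i + coeff (+ 0 ∷ P ⊗ Q) i
  coeff-∷-⊗ a P Q i =
    trans (coeff-⊕ (scale a Q) (+ 0 ∷ P ⊗ Q) i) (cong (λ x → x + _) (coeff-scale a Q i))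

  coeff-⊗ : ∀ P Q i → coeff (P ⊗ Q) i ≡ convolution (coeff P) (coeff Q) i
  coeff-⊗ [] Q i = sym (convolution-zeroˡ (coeff Q) i)
  coeff-⊗ (a ∷ P) Q zero = trans (coeff-∷-⊗ a P Q 0) (ℤ.+-identityʳ _)
  coeff-⊗ (a ∷ P) Q (suc i) =
    trans (coeff-∷-⊗ a P Q (suc i)) (cong (_+_ (a * coeff Q (suc i))) (coeff-⊗ P Q i))

  coeff-⊗-[] : ∀ P i → coeff (P ⊗ []) i ≡ + 0
  coeff-⊗-[] P i = trans (coeff-⊗ P [] i) (convolution-zeroʳ (coeff P) i)

  coeff-0∷-⊗ : ∀ P Q i → coeff ((+ 0 ∷ P) ⊗ Q) i ≡ coeff (+ 0 ∷ P ⊗ Q) i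
  coeff-0∷-⊗ P Q i = trans (coeff-∷-⊗ (+ 0) P Q i) (ℤ.+-identityˡ _)

  coeff-one-⊗ : ∀ P i → coeff (one ⊗ P) i ≡ coeff P i
  coeff-one-⊗ P zero = trans (coeff-∷-⊗ (+ 1) [] P 0) (trans (ℤ.+-identityʳ _) (ℤ.*-identityˡ _))
  coeff-one-⊗ P (suc i) = trans (coeff-∷-⊗ (+ 1) [] P (suc i)) (trans (ℤ.+-identityʳ _) (ℤ.*-identityˡ _))

  coeff-⊗-∷ : ∀ P b Q i → coeff (P ⊗ (b ∷ Q)) i ≡ coeff (scale b P) i + coeff (+ 0 ∷ P ⊗ Q) i
  coeff-⊗-∷ [] b Q zero = refl
  coeff-⊗-∷ [] b Q (suc i) = refl
  coeff-⊗-∷ (a ∷ P) b Q zero = cong (λ x → x + + 0) (ℤ.*-comm a b)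
  coeff-⊗-∷ (a ∷ P) b Q (suc i) = begin
    coeff ((a ∷ P) ⊗ (b ∷ Q)) (suc i)
      ≡⟨ coeff-∷-⊗ a P (b ∷ Q) (suc i) ⟩
    a * coeff Q i + coeff (P ⊗ (b ∷ Q)) i
      ≡⟨ cong (_+_ (a * coeff Q i)) (coeff-⊗-∷ P b Q i) ⟩
    a * coeff Q i + (coeff (scale b P) i + coeff (+ 0 ∷ P ⊗ Q) i)
      ≡⟨ solve 3 (λ x y z → x :+ (y :+ z) := y :+ (x :+ z)) refl
               (a * coeff Q i) (coeff (scale b P) i) (coeff (+ 0 ∷ P ⊗ Q) i) ⟩
    coeff (scale b P) i + (a * coeff Q i + coeff (+ 0 ∷ P ⊗ Q) i)
      ≡⟨ cong (_+_ (coeff (scale b P) i)) (coeff-∷-⊗ a P Q i) ⟨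
    coeff (scale b P) i + coeff ((a ∷ P) ⊗ Q) i ∎

  coeff-⊗-comm : ∀ P Q i → coeff (P ⊗ Q) i ≡ coeff (Q ⊗ P) i
  coeff-⊗-comm [] Q i = sym (coeff-⊗-[] Q i)
  coeff-⊗-comm (a ∷ P) Q i = begin
    coeff ((a ∷ P) ⊗ Q) i                         ≡⟨ coeff-∷-⊗ a P Q i ⟩
    a * coeff Q i + coeff (+ 0 ∷ P ⊗ Q) i         ≡⟨ cong₂ _+_ (coeff-scale a Q i) (shifted i) ⟨
    coeff (scale a Q) i + coeff (+ 0 ∷ Q ⊗ P) i   ≡⟨ coeff-⊗-∷ Q a P i ⟨
    coeff (Q ⊗ (a ∷ P)) i                         ∎
    where
    shifted : ∀ i → coeff (+ 0 ∷ Q ⊗ P) i ≡ coeff (+ 0 ∷ P ⊗ Q) i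
    shifted zero = refl
    shifted (suc i) = coeff-⊗-comm Q P i

  coeff-scale-⊗ : ∀ a P Q i → coeff (scale a P ⊗ Q) i ≡ a * coeff (P ⊗ Q) i
  coeff-scale-⊗ a [] Q i = sym (ℤ.*-zeroʳ a)
  coeff-scale-⊗ a (b ∷ P) Q i = begin
    coeff ((a * b ∷ scale a P) ⊗ Q) i
      ≡⟨ coeff-∷-⊗ (a * b) (scale a P) Q i ⟩
    a * b * coeff Q i + coeff (+ 0 ∷ scale a P ⊗ Q) i
      ≡⟨ cong (_+_ (a * b * coeff Q i)) (shifted i) ⟩
    a * b * coeff Q i + a * coeff (+ 0 ∷ P ⊗ Q) i
      ≡⟨ solve 4 (λ a b x y → a :* b :* x :+ a :* y := a :* (b :* x :+ y)) refl
               a b (coeff Q i) (coeff (+ 0 ∷ P ⊗ Q) i) ⟩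
    a * (b * coeff Q i + coeff (+ 0 ∷ P ⊗ Q) i)
      ≡⟨ cong (a *_) (coeff-∷-⊗ b P Q i) ⟨
    a * coeff ((b ∷ P) ⊗ Q) i ∎
    where
    shifted : ∀ i → coeff (+ 0 ∷ scale a P ⊗ Q) i ≡ a * coeff (+ 0 ∷ P ⊗ Q) i
    shifted zero = sym (ℤ.*-zeroʳ a)
    shifted (suc i) = coeff-scale-⊗ a P Q i

  coeff-⊗-distribʳ : ∀ P P′ Q i → coeff ((P ⊕ P′) ⊗ Q) i ≡ coeff (P ⊗ Q) i + coeff (P′ ⊗ Q) i
  coeff-⊗-distribʳ P P′ Q i = begin
    coeff ((P ⊕ P′) ⊗ Q) i
      ≡⟨ coeff-⊗ (P ⊕ P′) Q i ⟩
    convolution (coeff (P ⊕ P′)) (coeff Q) i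
      ≡⟨ convolution-cong _≡_ (cong₂ _+_) (cong₂ _*_) (coeff-⊕ P P′) (λ _ → refl) i ⟩
    convolution (λ j → coeff P j + coeff P′ j) (coeff Q) i
      ≡⟨ convolution-distribʳ (coeff P) (coeff P′) (coeff Q) i ⟩
    convolution (coeff P) (coeff Q) i + convolution (coeff P′) (coeff Q) i
      ≡⟨ cong₂ _+_ (coeff-⊗ P Q i) (coeff-⊗ P′ Q i) ⟨
    coeff (P ⊗ Q) i + coeff (P′ ⊗ Q) i ∎

  coeff-⊗-assoc : ∀ P Q R i → coeff ((P ⊗ Q) ⊗ R) i ≡ coeff (P ⊗ (Q ⊗ R)) i
  coeff-⊗-assoc [] Q R i = refl
  coeff-⊗-assoc (a ∷ P) Q R i = begin
    coeff ((scale a Q ⊕ (+ 0 ∷ P ⊗ Q)) ⊗ R) i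
      ≡⟨ coeff-⊗-distribʳ (scale a Q) (+ 0 ∷ P ⊗ Q) R i ⟩
    coeff (scale a Q ⊗ R) i + coeff ((+ 0 ∷ P ⊗ Q) ⊗ R) i
      ≡⟨ cong₂ _+_ (coeff-scale-⊗ a Q R i) (coeff-0∷-⊗ (P ⊗ Q) R i) ⟩
    a * coeff (Q ⊗ R) i + coeff (+ 0 ∷ (P ⊗ Q) ⊗ R) i
      ≡⟨ cong (_+_ (a * coeff (Q ⊗ R) i)) (shifted i) ⟩
    a * coeff (Q ⊗ R) i + coeff (+ 0 ∷ P ⊗ (Q ⊗ R)) i
      ≡⟨ coeff-∷-⊗ a P (Q ⊗ R) i ⟨
    coeff ((a ∷ P) ⊗ (Q ⊗ R)) i ∎
    where
    shifted : ∀ i → coeff (+ 0 ∷ (P ⊗ Q) ⊗ R) i ≡ coeff (+ 0 ∷ P ⊗ (Q ⊗ R)) i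
    shifted zero = refl
    shifted (suc i) = coeff-⊗-assoc P Q R i

  coeff-monomial-+ : ∀ a b i → coeff (monomial a ⊗ monomial b) i ≡ coeff (monomial (a ℕ.+ b)) i
  coeff-monomial-+ zero b i = coeff-one-⊗ (monomial b) i
  coeff-monomial-+ (suc a) b i = trans (coeff-0∷-⊗ (monomial a) (monomial b) i) (shifted i)
    where
    shifted : ∀ i → coeff (+ 0 ∷ monomial a ⊗ monomial b) i ≡ coeff (monomial (suc a ℕ.+ b)) i
    shifted zero = refl
    shifted (suc i) = coeff-monomial-+ a b i


module CoefficientwiseEquality where

  open import Defs
  open import Algebra.Definitions using (Congruent₁; Congruent₂)
  open import Data.Integer using (ℤ; -1ℤ; _+_; _*_)
  open import Relation.Binary.Bundles using (Setoid)
  open import Relation.Binary.Core using (Rel)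
  open import Relation.Binary.Structures using (IsEquivalence)
  open PolynomialArithmetic

  record Coefficientwise {ℓ} (_∼_ : Rel ℤ ℓ) (P Q : Poly) : Set ℓ where
    constructor coeffwise
    field coeff-∼ : ∀ i → coeff P i ∼ coeff Q i

  open Coefficientwise public

  negate : Poly → Poly
  negate = scale -1ℤ

  module _ {ℓ} {_∼_ : Rel ℤ ℓ} (∼-isEquivalence : IsEquivalence _∼_) where

    private
      ∼-setoid : Setoid _ _
      ∼-setoid = record { isEquivalence = ∼-isEquivalence }
      open Setoid ∼-setoid using (refl; sym; trans)
      open import Relation.Binary.Reasoning.Setoid ∼-setoid

    coeffwise-isEquivalence : IsEquivalence (Coefficientwise _∼_)
    coeffwise-isEquivalence = record
      { refl = coeffwise λ i → refl
      ; sym = λ (coeffwise P∼Q) → coeffwise λ i → sym (P∼Q i)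
      ; trans = λ (coeffwise P∼Q) (coeffwise Q∼R) → coeffwise λ i → trans (P∼Q i) (Q∼R i) }

    module _ (+-cong : Congruent₂ _∼_ _+_) (*-cong : Congruent₂ _∼_ _*_) where

      ⊕-cong : Congruent₂ (Coefficientwise _∼_) _⊕_
      ⊕-cong {P} {P′} {Q} {Q′} (coeffwise P∼P′) (coeffwise Q∼Q′) = coeffwise λ i → begin
        coeff (P ⊕ Q) i          ≡⟨ coeff-⊕ P Q i ⟩
        coeff P i + coeff Q i    ≈⟨ +-cong (P∼P′ i) (Q∼Q′ i) ⟩
        coeff P′ i + coeff Q′ i  ≡⟨ coeff-⊕ P′ Q′ i ⟨
        coeff (P′ ⊕ Q′) i        ∎

      ⊗-cong : Congruent₂ (Coefficientwise _∼_) _⊗_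
      ⊗-cong {P} {P′} {Q} {Q′} (coeffwise P∼P′) (coeffwise Q∼Q′) = coeffwise λ i → begin
        coeff (P ⊗ Q) i                      ≡⟨ coeff-⊗ P Q i ⟩
        convolution (coeff P) (coeff Q) i    ≈⟨ convolution-cong _∼_ +-cong *-cong P∼P′ Q∼Q′ i ⟩
        convolution (coeff P′) (coeff Q′) i  ≡⟨ coeff-⊗ P′ Q′ i ⟨
        coeff (P′ ⊗ Q′) i                    ∎

      negate-cong : Congruent₁ (Coefficientwise _∼_) negate
      negate-cong {P} {P′} (coeffwise P∼P′) = coeffwise λ i → begin
        coeff (negate P) i   ≡⟨ coeff-scale -1ℤ P i ⟩
        -1ℤ * coeff P i      ≈⟨ *-cong (refl { -1ℤ }) (P∼P′ i) ⟩
        -1ℤ * coeff P′ i     ≡⟨ coeff-scale -1ℤ P′ i ⟨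
        coeff (negate P′) i  ∎


module IntegerPolynomials where

  open import Defs
  open import Algebra.Definitions using (Congruent₁; Congruent₂)
  open import Data.Integer using (+_; -1ℤ; _+_; _*_)
  import Data.Integer.Properties as ℤ
  open import Data.Integer.Solver using (module +-*-Solver)
  open import Data.List using ([])
  open import Data.Product using (_,_)
  import Data.Nat as ℕ
  open import Level using (0ℓ)
  open import Relation.Binary.PropositionalEquality
  open import Relation.Binary.Structures using (IsEquivalence)
  open PolynomialArithmetic
  open CoefficientwiseEquality
  open +-*-Solver
  open ≡-Reasoning

  infix 4 _≗ᶜ_

  _≗ᶜ_ : Poly → Poly → Set
  _≗ᶜ_ = Coefficientwise _≡_

  ≗ᶜ-isEquivalence : IsEquivalence _≗ᶜ_
  ≗ᶜ-isEquivalence = coeffwise-isEquivalence isEquivalence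

  ⊕-assoc : ∀ P Q R → (P ⊕ Q) ⊕ R ≗ᶜ P ⊕ (Q ⊕ R)
  ⊕-assoc P Q R = coeffwise λ i → begin
    coeff ((P ⊕ Q) ⊕ R) i                ≡⟨ coeff-⊕ (P ⊕ Q) R i ⟩
    coeff (P ⊕ Q) i + coeff R i          ≡⟨ cong (λ x → x + coeff R i) (coeff-⊕ P Q i) ⟩
    coeff P i + coeff Q i + coeff R i    ≡⟨ ℤ.+-assoc (coeff P i) (coeff Q i) (coeff R i) ⟩
    coeff P i + (coeff Q i + coeff R i)  ≡⟨ cong (_+_ (coeff P i)) (coeff-⊕ Q R i) ⟨
    coeff P i + coeff (Q ⊕ R) i          ≡⟨ coeff-⊕ P (Q ⊕ R) i ⟨
    coeff (P ⊕ (Q ⊕ R)) i                ∎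

  ⊕-comm : ∀ P Q → P ⊕ Q ≗ᶜ Q ⊕ P
  ⊕-comm P Q = coeffwise λ i →
    trans (coeff-⊕ P Q i) (trans (ℤ.+-comm (coeff P i) (coeff Q i)) (sym (coeff-⊕ Q P i)))

  ⊕-identityʳ : ∀ P → P ⊕ [] ≗ᶜ P
  ⊕-identityʳ P = coeffwise λ i → trans (coeff-⊕ P [] i) (ℤ.+-identityʳ (coeff P i))

  negate-inverseˡ : ∀ P → negate P ⊕ P ≗ᶜ []
  negate-inverseˡ P = coeffwise λ i → begin
    coeff (negate P ⊕ P) i          ≡⟨ coeff-⊕ (negate P) P i ⟩
    coeff (negate P) i + coeff P i  ≡⟨ cong (λ x → x + coeff P i) (coeff-scale -1ℤ P i) ⟩
    -1ℤ * coeff P i + coeff P i     ≡⟨ solve 1 (λ x → con -1ℤ :* x :+ x := con (+ 0)) refl (coeff P i) ⟩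
    + 0                             ∎

  negate-inverseʳ : ∀ P → P ⊕ negate P ≗ᶜ []
  negate-inverseʳ P = coeffwise λ i →
    trans (coeff-∼ (⊕-comm P (negate P)) i) (coeff-∼ (negate-inverseˡ P) i)

  ⊗-distribʳ : ∀ P Q R → (Q ⊕ R) ⊗ P ≗ᶜ Q ⊗ P ⊕ R ⊗ P
  ⊗-distribʳ P Q R = coeffwise λ i → trans (coeff-⊗-distribʳ Q R P i) (sym (coeff-⊕ (Q ⊗ P) (R ⊗ P) i))

  ⊗-distribˡ : ∀ P Q R → P ⊗ (Q ⊕ R) ≗ᶜ P ⊗ Q ⊕ P ⊗ R
  ⊗-distribˡ P Q R = coeffwise λ i → begin
    coeff (P ⊗ (Q ⊕ R)) i                ≡⟨ coeff-⊗-comm P (Q ⊕ R) i ⟩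
    coeff ((Q ⊕ R) ⊗ P) i                ≡⟨ coeff-⊗-distribʳ Q R P i ⟩
    coeff (Q ⊗ P) i + coeff (R ⊗ P) i    ≡⟨ cong₂ _+_ (coeff-⊗-comm Q P i) (coeff-⊗-comm R P i) ⟩
    coeff (P ⊗ Q) i + coeff (P ⊗ R) i    ≡⟨ coeff-⊕ (P ⊗ Q) (P ⊗ R) i ⟨
    coeff (P ⊗ Q ⊕ P ⊗ R) i              ∎

  ℤ[x] : CommutativeRing 0ℓ 0ℓ
  ℤ[x] = record
    { Carrier = Poly ; _≈_ = _≗ᶜ_ ; _+_ = _⊕_ ; _*_ = _⊗_ ; -_ = negate ; 0# = [] ; 1# = one
    ; isCommutativeRing = record
      { isRing = record
        { +-isAbelianGroup = record
          { isGroup = record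
            { isMonoid = record
              { isSemigroup = record
                { isMagma = record { isEquivalence = ≗ᶜ-isEquivalence ; ∙-cong = ⊕-cong-≗ᶜ }
                ; assoc = ⊕-assoc }
              ; identity = (λ P → coeffwise λ i → refl) , ⊕-identityʳ }
            ; inverse = negate-inverseˡ , negate-inverseʳ
            ; ⁻¹-cong = negate-cong-≗ᶜ }
          ; comm = ⊕-comm }
        ; *-cong = ⊗-cong-≗ᶜ
        ; *-assoc = λ P Q R → coeffwise (coeff-⊗-assoc P Q R)
        ; *-identity = (λ P → coeffwise (coeff-one-⊗ P))
                     , (λ P → coeffwise λ i → trans (coeff-⊗-comm P one i) (coeff-one-⊗ P i))
        ; distrib = ⊗-distribˡ , ⊗-distribʳ }
      ; *-comm = λ P Q → coeffwise (coeff-⊗-comm P Q) } }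
    where
    ⊕-cong-≗ᶜ : Congruent₂ _≗ᶜ_ _⊕_
    ⊕-cong-≗ᶜ = ⊕-cong isEquivalence (cong₂ _+_) (cong₂ _*_)
    ⊗-cong-≗ᶜ : Congruent₂ _≗ᶜ_ _⊗_
    ⊗-cong-≗ᶜ = ⊗-cong isEquivalence (cong₂ _+_) (cong₂ _*_)
    negate-cong-≗ᶜ : Congruent₁ _≗ᶜ_ negate
    negate-cong-≗ᶜ = negate-cong isEquivalence (cong₂ _+_) (cong₂ _*_)

  monomial-+ : ∀ a b → monomial a ⊗ monomial b ≗ᶜ monomial (a ℕ.+ b)
  monomial-+ a b = coeffwise (coeff-monomial-+ a b)


module PolynomialsModulo (n : ℕ) where

  open import Defs
  open import Data.Integer.Divisibility.Signed using (∣⇒∣ᵤ)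
  open CoefficientwiseEquality
  open IntegerPolynomials
  open IntegersModulo n
  open Quotient

  infix 4 _≈ₘ_

  _≈ₘ_ : Poly → Poly → Set
  _≈ₘ_ = Coefficientwise _≡ₘ_

  ≗ᶜ⇒≈ₘ : ∀ {P Q} → P ≗ᶜ Q → P ≈ₘ Q
  ≗ᶜ⇒≈ₘ (coeffwise P≗Q) = coeffwise λ i → ≡⇒≡ₘ (P≗Q i)

  ℤmod[x] : CommutativeRing _ _
  ℤmod[x] = quotientCommutativeRing ℤ[x] _≈ₘ_ (coeffwise-isEquivalence ≡ₘ-isEquivalence) ≗ᶜ⇒≈ₘ
    (⊕-cong ≡ₘ-isEquivalence +-cong-≡ₘ *-cong-≡ₘ)
    (⊗-cong ≡ₘ-isEquivalence +-cong-≡ₘ *-cong-≡ₘ)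
    (negate-cong ≡ₘ-isEquivalence +-cong-≡ₘ *-cong-≡ₘ)

  ≈ₘ⇒≡ₚ : ∀ {P Q} → P ≈ₘ Q → P ≡ₚ Q [mod n ]
  ≈ₘ⇒≡ₚ (coeffwise P≈Q) i = ∣⇒∣ᵤ (n∣a-b (P≈Q i))


module Evaluation where

  open import Defs
  open import Data.Integer using (ℤ; +_; -1ℤ; _+_; _*_; _-_; _^_)
  import Data.Integer.Properties as ℤ
  open import Data.Integer.Divisibility.Signed using (_∣_; ∣m∣n⇒∣m+n; ∣n⇒∣m*n)
  open import Data.Integer.Solver using (module +-*-Solver)
  open import Data.List using ([]; _∷_)
  open import Data.Nat using (zero; suc)
  open import Function using (_∘_)
  open import Relation.Binary.PropositionalEquality
  open PolynomialArithmetic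
  open CoefficientwiseEquality using (coeffwise; negate)
  open +-*-Solver
  open ≡-Reasoning

  eval-⊕ : ∀ P Q k → eval (P ⊕ Q) k ≡ eval P k + eval Q k
  eval-⊕ [] Q k = sym (ℤ.+-identityˡ _)
  eval-⊕ (a ∷ P) [] k = sym (ℤ.+-identityʳ _)
  eval-⊕ (a ∷ P) (b ∷ Q) k = begin
    a + b + k * eval (P ⊕ Q) k
      ≡⟨ cong (λ e → a + b + k * e) (eval-⊕ P Q k) ⟩
    a + b + k * (eval P k + eval Q k)
      ≡⟨ solve 5 (λ a b k x y → a :+ b :+ k :* (x :+ y) := a :+ k :* x :+ (b :+ k :* y)) refl
               a b k (eval P k) (eval Q k) ⟩
    a + k * eval P k + (b + k * eval Q k) ∎

  eval-scale : ∀ c P k → eval (scale c P) k ≡ c * eval P k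
  eval-scale c [] k = sym (ℤ.*-zeroʳ c)
  eval-scale c (a ∷ P) k = begin
    c * a + k * eval (scale c P) k
      ≡⟨ cong (λ e → c * a + k * e) (eval-scale c P k) ⟩
    c * a + k * (c * eval P k)
      ≡⟨ solve 4 (λ c a k x → c :* a :+ k :* (c :* x) := c :* (a :+ k :* x)) refl c a k (eval P k) ⟩
    c * (a + k * eval P k) ∎

  eval-⊗ : ∀ P Q k → eval (P ⊗ Q) k ≡ eval P k * eval Q k
  eval-⊗ [] Q k = sym (ℤ.*-zeroˡ (eval Q k))
  eval-⊗ (a ∷ P) Q k = begin
    eval (scale a Q ⊕ (+ 0 ∷ P ⊗ Q)) k
      ≡⟨ eval-⊕ (scale a Q) (+ 0 ∷ P ⊗ Q) k ⟩
    eval (scale a Q) k + (+ 0 + k * eval (P ⊗ Q) k)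
      ≡⟨ cong₂ (λ e f → e + (+ 0 + k * f)) (eval-scale a Q k) (eval-⊗ P Q k) ⟩
    a * eval Q k + (+ 0 + k * (eval P k * eval Q k))
      ≡⟨ solve 4 (λ a q k x → a :* q :+ (con (+ 0) :+ k :* (x :* q)) := (a :+ k :* x) :* q) refl
               a (eval Q k) k (eval P k) ⟩
    (a + k * eval P k) * eval Q k ∎

  eval-^ᵖ : ∀ P m k → eval (P ^ᵖ m) k ≡ eval P k ^ m
  eval-^ᵖ P zero k = solve 1 (λ k → con (+ 1) :+ k :* con (+ 0) := con (+ 1)) refl k
  eval-^ᵖ P (suc m) k = trans (eval-⊗ P (P ^ᵖ m) k) (cong (eval P k *_) (eval-^ᵖ P m k))

  eval-x-1 : ∀ k → eval x-1 k ≡ k - + 1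
  eval-x-1 k = solve 1 (λ k → con -1ℤ :+ k :* (con (+ 1) :+ k :* con (+ 0)) := k :- con (+ 1)) refl k

  coeff-⊕-negate : ∀ P Q i → coeff (P ⊕ negate Q) i ≡ coeff P i - coeff Q i
  coeff-⊕-negate P Q i = begin
    coeff (P ⊕ negate Q) i          ≡⟨ coeff-⊕ P (negate Q) i ⟩
    coeff P i + coeff (negate Q) i  ≡⟨ cong (_+_ (coeff P i)) (coeff-scale -1ℤ Q i) ⟩
    coeff P i + -1ℤ * coeff Q i     ≡⟨ cong (_+_ (coeff P i)) (ℤ.-1*i≡-i (coeff Q i)) ⟩
    coeff P i - coeff Q i           ∎

  eval-⊕-negate : ∀ P Q k → eval (P ⊕ negate Q) k ≡ eval P k - eval Q k
  eval-⊕-negate P Q k = begin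
    eval (P ⊕ negate Q) k           ≡⟨ eval-⊕ P (negate Q) k ⟩
    eval P k + eval (negate Q) k    ≡⟨ cong (_+_ (eval P k)) (eval-scale -1ℤ Q k) ⟩
    eval P k + -1ℤ * eval Q k       ≡⟨ cong (_+_ (eval P k)) (ℤ.-1*i≡-i (eval Q k)) ⟩
    eval P k - eval Q k             ∎

  module _ (n : ℕ) where

    open IntegersModulo n using (_≡ₘ_; mod; n∣a-b)
    open PolynomialsModulo n using (_≈ₘ_)

    ∣-eval : ∀ P k → (∀ i → + n ∣ coeff P i) → + n ∣ eval P k
    ∣-eval [] k n∣coeff = ∣n⇒∣m*n (+ 0) (n∣coeff 0)
    ∣-eval (a ∷ P) k n∣coeff =
      ∣m∣n⇒∣m+n (n∣coeff 0) (∣n⇒∣m*n k (∣-eval P k (n∣coeff ∘ suc)))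

    eval-cong : ∀ {P Q} k → P ≈ₘ Q → eval P k ≡ₘ eval Q k
    eval-cong {P} {Q} k (coeffwise P≈Q) =
      mod (subst (+ n ∣_) (eval-⊕-negate P Q k) (∣-eval (P ⊕ negate Q) k n∣coeff))
      where
      n∣coeff : ∀ i → + n ∣ coeff (P ⊕ negate Q) i
      n∣coeff i = subst (+ n ∣_) (sym (coeff-⊕-negate P Q i)) (n∣a-b (P≈Q i))


module BinomialCoefficients where

  open import Data.Nat
  open import Data.Nat.Combinatorics using (_C_; nCk≡n!/k![n-k]!; k![n∸k]!∣n!)
  open import Data.Nat.Combinatorics.Specification using (k>n⇒nCk≡0)
  open import Data.Nat.Divisibility using (_∣_; ∣-refl; ∣m⇒∣m*n; ∣⇒≤)
  open import Data.Nat.DivMod using (m/n*n≡m)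
  open import Data.Nat.Primality using (euclidsLemma)
  open import Data.Nat.Properties
  open import Data.Nat.Solver using (module +-*-Solver)
  open import Data.Sum using (inj₁; inj₂)
  open import Relation.Nullary using (yes; no; contradiction)
  open import Relation.Binary.PropositionalEquality
  open +-*-Solver
  open ≡-Reasoning

  nCk*k!*[n∸k]!≡n! : ∀ {n k} → k ≤ n → (n C k) * (k ! * (n ∸ k) !) ≡ n !
  nCk*k!*[n∸k]!≡n! {n} {k} k≤n = begin
    (n C k) * (k ! * (n ∸ k) !)
      ≡⟨ cong (_* (k ! * (n ∸ k) !)) (nCk≡n!/k![n-k]! k≤n) ⟩
    (n ! / (k ! * (n ∸ k) !)) {{k !* (n ∸ k) !≢0}} * (k ! * (n ∸ k) !)
      ≡⟨ m/n*n≡m {{k !* (n ∸ k) !≢0}} (k![n∸k]!∣n! k≤n) ⟩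
    n ! ∎

  [k+1]*[n+1]C[k+1]≡[n+1]*nCk : ∀ n k → suc k * (suc n C suc k) ≡ suc n * (n C k)
  [k+1]*[n+1]C[k+1]≡[n+1]*nCk n k with k ≤? n
  ... | no k≰n = begin
    suc k * (suc n C suc k)  ≡⟨ cong (suc k *_) (k>n⇒nCk≡0 (s≤s (≰⇒> k≰n))) ⟩
    suc k * 0                ≡⟨ *-zeroʳ (suc k) ⟩
    0                        ≡⟨ *-zeroʳ (suc n) ⟨
    suc n * 0                ≡⟨ cong (suc n *_) (k>n⇒nCk≡0 (≰⇒> k≰n)) ⟨
    suc n * (n C k)          ∎
  ... | yes k≤n = *-cancelʳ-≡ _ _ (k ! * (n ∸ k) !) {{k !* (n ∸ k) !≢0}} (begin
    suc k * (suc n C suc k) * (k ! * (n ∸ k) !)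
      ≡⟨ solve 4 (λ x c f g → x :* c :* (f :* g) := c :* ((x :* f) :* g)) refl
               (suc k) (suc n C suc k) (k !) ((n ∸ k) !) ⟩
    (suc n C suc k) * (suc k ! * (n ∸ k) !)
      ≡⟨ nCk*k!*[n∸k]!≡n! (s≤s k≤n) ⟩
    suc n * n !
      ≡⟨ cong (suc n *_) (nCk*k!*[n∸k]!≡n! k≤n) ⟨
    suc n * ((n C k) * (k ! * (n ∸ k) !))
      ≡⟨ *-assoc (suc n) (n C k) _ ⟨
    suc n * (n C k) * (k ! * (n ∸ k) !) ∎)

  [n+1]C[k+1]*[k+1]!≡[n+1]*nCk*k! : ∀ n k → (suc n C suc k) * suc k ! ≡ suc n * ((n C k) * k !)
  [n+1]C[k+1]*[k+1]!≡[n+1]*nCk*k! n k = begin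
    (suc n C suc k) * (suc k * k !)
      ≡⟨ solve 3 (λ c x f → c :* (x :* f) := (x :* c) :* f) refl (suc n C suc k) (suc k) (k !) ⟩
    suc k * (suc n C suc k) * k !
      ≡⟨ cong (_* k !) ([k+1]*[n+1]C[k+1]≡[n+1]*nCk n k) ⟩
    suc n * (n C k) * k !
      ≡⟨ *-assoc (suc n) (n C k) (k !) ⟩
    suc n * ((n C k) * k !) ∎

  p∣pCk : ∀ {p k} → Prime p → 0 < k → k < p → p ∣ p C k
  p∣pCk {suc q} {suc j} p-prime _ k<p with euclidsLemma (suc j) (suc q C suc j) p-prime p∣k*pCk
    where
    p∣k*pCk : suc q ∣ suc j * (suc q C suc j)
    p∣k*pCk = subst (suc q ∣_) (sym ([k+1]*[n+1]C[k+1]≡[n+1]*nCk q j)) (∣m⇒∣m*n (q C j) ∣-refl)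
  ... | inj₁ p∣k = contradiction (∣⇒≤ p∣k) (<⇒≱ k<p)
  ... | inj₂ p∣pCk = p∣pCk


module Powers {a ℓ} (R : CommutativeRing a ℓ) where

  open CommutativeRing R
  open import Algebra.Properties.Monoid.Sum *-monoid public using () renaming (sum to ∏; sum-cong-≋ to ∏-cong)
  open import Algebra.Properties.Semiring.Exp semiring
  open import Data.Fin as Fin using (Fin)
  import Data.Nat as ℕ
  open import Data.Nat using (zero; suc; NonZero)
  import Data.Nat.Properties as ℕₚ
  open import Defs using (sumFin)
  open import Function using (_∘_)
  open import Relation.Binary.PropositionalEquality as ≡ using ()
  open import Relation.Binary.Reasoning.Setoid setoid

  0#^n≈0# : ∀ n .{{_ : NonZero n}} → 0# ^ n ≈ 0#
  0#^n≈0# (suc n) = zeroˡ _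

  1#^n≈1# : ∀ n → 1# ^ n ≈ 1#
  1#^n≈1# zero = refl
  1#^n≈1# (suc n) = trans (*-identityˡ _) (1#^n≈1# n)

  ^-^-p^[1+k] : ∀ p k x → x ^ (p ℕ.^ suc k) ≈ (x ^ (p ℕ.^ k)) ^ p
  ^-^-p^[1+k] p k x = trans (^-congʳ x (ℕₚ.*-comm p (p ℕ.^ k))) (sym (^-assocʳ x (p ℕ.^ k) p))

  ^-p≈⇒^-p^k≈ : ∀ {p x} → x ^ p ≈ x → ∀ k → x ^ (p ℕ.^ k) ≈ x
  ^-p≈⇒^-p^k≈ {p} {x} x^p≈x zero = *-identityʳ x
  ^-p≈⇒^-p^k≈ {p} {x} x^p≈x (suc k) = begin
    x ^ (p ℕ.^ suc k)        ≈⟨ ^-^-p^[1+k] p k x ⟩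
    (x ^ (p ℕ.^ k)) ^ p      ≈⟨ ^-congˡ p (^-p≈⇒^-p^k≈ x^p≈x k) ⟩
    x ^ p                    ≈⟨ x^p≈x ⟩
    x                        ∎

  ^-homo-sumFin : ∀ x {n} (f : Fin n → ℕ) → x ^ sumFin f ≈ ∏ (λ i → x ^ f i)
  ^-homo-sumFin x {zero} f = refl
  ^-homo-sumFin x {suc n} f = begin
    x ^ (f Fin.zero ℕ.+ sumFin (f ∘ Fin.suc))             ≈⟨ ^-homo-* x (f Fin.zero) (sumFin (f ∘ Fin.suc)) ⟩
    x ^ f Fin.zero * x ^ sumFin (f ∘ Fin.suc)             ≈⟨ *-congˡ (^-homo-sumFin x (f ∘ Fin.suc)) ⟩
    x ^ f Fin.zero * ∏ (λ i → x ^ f (Fin.suc i))          ∎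

  ^-sumFin-* : ∀ x {n} (f e : Fin n → ℕ) →
    x ^ sumFin (λ i → f i ℕ.* e i) ≈ ∏ (λ i → (x ^ e i) ^ f i)
  ^-sumFin-* x f e = trans (^-homo-sumFin x (λ i → f i ℕ.* e i)) (∏-cong λ i → begin
    x ^ (f i ℕ.* e i)     ≡⟨ ≡.cong (x ^_) (ℕₚ.*-comm (f i) (e i)) ⟩
    x ^ (e i ℕ.* f i)     ≈⟨ ^-assocʳ x (e i) (f i) ⟨
    (x ^ e i) ^ f i       ∎)


module Frobenius {a ℓ} (R : CommutativeRing a ℓ) where

  open CommutativeRing R hiding (zero)
  open import Algebra.Properties.CommutativeSemiring.Binomial commutativeSemiring
  open import Algebra.Properties.Group +-group using (inverseʳ-unique)
  open import Algebra.Properties.Monoid.Sum +-monoid using (sum; sum-cong-≋; sum-init-last; sum-replicate-zero)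
  open import Algebra.Properties.Semiring.Exp semiring
  open import Algebra.Properties.Semiring.Mult semiring
  open import Data.Fin using (Fin; toℕ; zero; suc; inject₁; fromℕ)
  open import Data.Fin.Properties using (toℕ-fromℕ; inject₁ℕ<)
  import Data.Nat as ℕ
  open import Data.Nat using (suc; s≤s; z≤n; NonZero)
  open import Data.Nat.Combinatorics using (_C_; nCn≡1)
  open import Data.Nat.Divisibility using (_∣_; divides)
  open import Data.Nat.Primality using (prime⇒nonZero)
  open import Data.Nat.Properties using (n∸n≡0)
  open import Function using (_∘_)
  open import Relation.Binary.PropositionalEquality as ≡ using (refl)
  open import Relation.Binary.Reasoning.Setoid setoid
  open BinomialCoefficients using (p∣pCk)
  open Powers R using (0#^n≈0#; ^-^-p^[1+k])

  ∣⇒×≈0# : ∀ {p c} → p × 1# ≈ 0# → p ∣ c → ∀ x → c × x ≈ 0#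
  ∣⇒×≈0# {p} p×1≈0 (divides d refl) x = begin
    (d ℕ.* p) × x              ≈⟨ ×-congʳ (d ℕ.* p) (*-identityˡ x) ⟨
    (d ℕ.* p) × (1# * x)       ≈⟨ ×-assoc-* (d ℕ.* p) 1# x ⟨
    ((d ℕ.* p) × 1#) * x       ≈⟨ *-congʳ (×1-homo-* d p) ⟩
    (d × 1#) * (p × 1#) * x    ≈⟨ *-congʳ (*-congˡ p×1≈0) ⟩
    (d × 1#) * 0# * x          ≈⟨ *-congʳ (zeroʳ (d × 1#)) ⟩
    0# * x                     ≈⟨ zeroˡ x ⟩
    0#                         ∎

  frobenius : ∀ {p} → Prime p → p × 1# ≈ 0# → ∀ x y → (x + y) ^ p ≈ x ^ p + y ^ p
  frobenius {suc q} p-prime p×1≈0 x y = begin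
    (x + y) ^ suc q                                      ≈⟨ theorem (suc q) x y ⟩
    term zero + sum (term ∘ suc)                         ≈⟨ +-cong first≈y^p (sum-init-last (term ∘ suc)) ⟩
    y ^ suc q + (sum (λ i → term (suc (inject₁ i))) + term (suc (fromℕ q)))
                                                         ≈⟨ +-congˡ (+-cong middle≈0 last≈x^p) ⟩
    y ^ suc q + (0# + x ^ suc q)                         ≈⟨ +-congˡ (+-identityˡ _) ⟩
    y ^ suc q + x ^ suc q                                ≈⟨ +-comm _ _ ⟩
    x ^ suc q + y ^ suc q                                ∎
    where
    term : Fin (suc (suc q)) → Carrier
    term = binomialTerm x y (suc q)

    first≈y^p : term zero ≈ y ^ suc q
    first≈y^p = trans (+-identityʳ _) (*-identityˡ _)

    middle≈0 : sum (λ i → term (suc (inject₁ i))) ≈ 0#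
    middle≈0 = trans (sum-cong-≋ λ i → ∣⇒×≈0# p×1≈0 (p∣pCk p-prime (s≤s z≤n) (s≤s (inject₁ℕ< i))) _)
                     (sum-replicate-zero q)

    last≈x^p : term (suc (fromℕ q)) ≈ x ^ suc q
    last≈x^p = begin
      (suc q C suc (toℕ (fromℕ q))) × (x ^ suc (toℕ (fromℕ q)) * y ^ (q ℕ.∸ toℕ (fromℕ q)))
        ≡⟨ ≡.cong (λ k → (suc q C suc k) × (x ^ suc k * y ^ (q ℕ.∸ k))) (toℕ-fromℕ q) ⟩
      (suc q C suc q) × (x ^ suc q * y ^ (q ℕ.∸ q))   ≈⟨ ×-congˡ (nCn≡1 (suc q)) ⟩
      1 × (x ^ suc q * y ^ (q ℕ.∸ q))                 ≈⟨ ×-homo-1 _ ⟩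
      x ^ suc q * y ^ (q ℕ.∸ q)                       ≈⟨ *-congˡ (^-congʳ y (n∸n≡0 q)) ⟩
      x ^ suc q * 1#                                  ≈⟨ *-identityʳ _ ⟩
      x ^ suc q                                       ∎

  module _ {p} (p-prime : Prime p) (p×1≈0 : p × 1# ≈ 0#) where

    private
      instance
        p-nonZero : NonZero p
        p-nonZero = prime⇒nonZero p-prime

    frobenius-neg : ∀ x → (- x) ^ p ≈ - (x ^ p)
    frobenius-neg x = inverseʳ-unique (x ^ p) ((- x) ^ p) (begin
      x ^ p + (- x) ^ p  ≈⟨ frobenius p-prime p×1≈0 x (- x) ⟨
      (x - x) ^ p        ≈⟨ ^-congˡ p (-‿inverseʳ x) ⟩
      0# ^ p             ≈⟨ 0#^n≈0# p ⟩
      0#                 ∎)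

    frobenius-iterate : ∀ k x y → (x + y) ^ (p ℕ.^ k) ≈ x ^ (p ℕ.^ k) + y ^ (p ℕ.^ k)
    frobenius-iterate ℕ.zero x y = trans (*-identityʳ _) (sym (+-cong (*-identityʳ x) (*-identityʳ y)))
    frobenius-iterate (suc k) x y = begin
      (x + y) ^ (p ℕ.^ suc k)                     ≈⟨ ^-^-p^[1+k] p k (x + y) ⟩
      ((x + y) ^ (p ℕ.^ k)) ^ p                   ≈⟨ ^-congˡ p (frobenius-iterate k x y) ⟩
      (x ^ (p ℕ.^ k) + y ^ (p ℕ.^ k)) ^ p         ≈⟨ frobenius p-prime p×1≈0 _ _ ⟩
      (x ^ (p ℕ.^ k)) ^ p + (y ^ (p ℕ.^ k)) ^ p   ≈⟨ +-cong (^-^-p^[1+k] p k x) (^-^-p^[1+k] p k y) ⟨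
      x ^ (p ℕ.^ suc k) + y ^ (p ℕ.^ suc k)       ∎


module DerangementRecurrence where

  open import Defs
  open import Data.Integer using (+_)
  import Data.Integer.Properties as ℤ
  open import Data.List using (List; []; _∷_; map; foldr; upTo; applyUpTo)
  open import Data.List.Properties using (map-applyUpTo)
  import Data.Nat as ℕ
  open import Data.Nat using (zero; suc; _!)
  open import Data.Nat.Combinatorics using (_C_)
  open import Function using (_∘_; id)
  open import Relation.Binary.PropositionalEquality as ≡ using (_≡_)
  open CoefficientwiseEquality using (coeffwise)
  open IntegerPolynomials using (_≗ᶜ_; ℤ[x])
  open CommutativeRing ℤ[x]
    using (setoid; sym; trans; +-cong; *-congʳ; *-assoc; *-identityˡ; zeroʳ; distribˡ)
  open BinomialCoefficients using ([n+1]C[k+1]*[k+1]!≡[n+1]*nCk*k!)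
  open import Relation.Binary.Reasoning.Setoid setoid

  derangementTerm : ℕ → ℕ → Poly
  derangementTerm n k = const (+ ((n C k) ℕ.* (k !))) ⊗ (x-1 ^ᵖ (n ℕ.∸ k))

  sum : List Poly → Poly
  sum = foldr _⊕_ []

  sum-map-scale : ∀ c (G H : ℕ → Poly) l → (∀ j → G j ≗ᶜ c ⊗ H j) →
    sum (map G l) ≗ᶜ c ⊗ sum (map H l)
  sum-map-scale c G H [] G≈cH = sym (zeroʳ c)
  sum-map-scale c G H (j ∷ l) G≈cH =
    trans (+-cong (G≈cH j) (sum-map-scale c G H l G≈cH)) (sym (distribˡ c (H j) (sum (map H l))))

  const-* : ∀ a b → const (+ (a ℕ.* b)) ≗ᶜ const (+ a) ⊗ const (+ b)
  const-* a b = coeffwise λ where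
    zero → ≡.trans (ℤ.pos-* a b) (≡.sym (ℤ.+-identityʳ _))
    (suc i) → ≡.refl

  derangementTerm-suc : ∀ n k → derangementTerm (suc n) (suc k) ≗ᶜ const (+ suc n) ⊗ derangementTerm n k
  derangementTerm-suc n k = begin
    const (+ ((suc n C suc k) ℕ.* (suc k !))) ⊗ x-1 ^ᵖ (n ℕ.∸ k)
      ≡⟨ ≡.cong (λ c → const (+ c) ⊗ x-1 ^ᵖ (n ℕ.∸ k)) ([n+1]C[k+1]*[k+1]!≡[n+1]*nCk*k! n k) ⟩
    const (+ (suc n ℕ.* ((n C k) ℕ.* k !))) ⊗ x-1 ^ᵖ (n ℕ.∸ k)
      ≈⟨ *-congʳ (const-* (suc n) ((n C k) ℕ.* k !)) ⟩
    const (+ suc n) ⊗ const (+ ((n C k) ℕ.* k !)) ⊗ x-1 ^ᵖ (n ℕ.∸ k)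
      ≈⟨ *-assoc (const (+ suc n)) (const (+ ((n C k) ℕ.* k !))) (x-1 ^ᵖ (n ℕ.∸ k)) ⟩
    const (+ suc n) ⊗ derangementTerm n k ∎

  derangement-suc : ∀ n → derangement (suc n) ≗ᶜ x-1 ^ᵖ suc n ⊕ const (+ suc n) ⊗ derangement n
  derangement-suc n = begin
    derangement (suc n)
      ≡⟨⟩
    derangementTerm (suc n) 0 ⊕ sum (map (derangementTerm (suc n)) (applyUpTo suc (suc n)))
      ≡⟨ ≡.cong (λ l → derangementTerm (suc n) 0 ⊕ sum l) shift-indices ⟩
    derangementTerm (suc n) 0 ⊕ sum (map (derangementTerm (suc n) ∘ suc) (upTo (suc n)))
      ≈⟨ +-cong (*-identityˡ (x-1 ^ᵖ suc n))
                (sum-map-scale (const (+ suc n)) _ (derangementTerm n) (upTo (suc n)) (derangementTerm-suc n)) ⟩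
    x-1 ^ᵖ suc n ⊕ const (+ suc n) ⊗ derangement n ∎
    where
    shift-indices : map (derangementTerm (suc n)) (applyUpTo suc (suc n))
                  ≡ map (derangementTerm (suc n) ∘ suc) (upTo (suc n))
    shift-indices = ≡.trans (map-applyUpTo suc (derangementTerm (suc n)) (suc n))
                            (≡.sym (map-applyUpTo id (derangementTerm (suc n) ∘ suc) (suc n)))


module FermatLittleTheorem {p : ℕ} (p-prime : Prime p) where

  open import Data.Fin using (Fin)
  open import Data.Integer as ℤ using (ℤ; +_; -[1+_]; 0ℤ)
  import Data.Nat as ℕ
  open import Data.Nat using (zero; suc; NonZero)
  open import Data.Nat.Primality using (prime⇒nonZero)
  open import Defs using (sumFin)
  open import Relation.Binary.PropositionalEquality as ≡ using (_≡_)
  open IntegersModulo p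
  open CommutativeRing ℤmod hiding (zero)
  open import Algebra.Properties.Semiring.Exp semiring
  open import Algebra.Properties.Semiring.Mult semiring using (_×_)
  open import Relation.Binary.Reasoning.Setoid setoid
  open Frobenius ℤmod
  open Powers ℤmod

  private
    instance
      p-nonZero : NonZero p
      p-nonZero = prime⇒nonZero p-prime

  n×1≡+n : ∀ n → n × + 1 ≡ + n
  n×1≡+n zero = ≡.refl
  n×1≡+n (suc n) = ≡.cong (ℤ._+_ (+ 1)) (n×1≡+n n)

  p×1≈0 : p × + 1 ≈ 0ℤ
  p×1≈0 = trans (reflexive (n×1≡+n p)) (+[m+n]≡ₘ+m 0)

  fermat : ∀ a → a ^ p ≈ a
  fermat (+ n) = fermat-+ n
    where
    fermat-+ : ∀ n → (+ n) ^ p ≈ + n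
    fermat-+ zero = 0#^n≈0# p
    fermat-+ (suc n) = trans (frobenius p-prime p×1≈0 (+ 1) (+ n)) (+-cong (1#^n≈1# p) (fermat-+ n))
  fermat -[1+ n ] = trans (frobenius-neg p-prime p×1≈0 (+ suc n)) (-‿cong (fermat (+ suc n)))

  ^-sumFin-*p^≈^-sumFin : ∀ a {s} (f e : Fin s → ℕ) →
    a ^ sumFin (λ i → f i ℕ.* p ℕ.^ e i) ≈ a ^ sumFin f
  ^-sumFin-*p^≈^-sumFin a f e = begin
    a ^ sumFin (λ i → f i ℕ.* p ℕ.^ e i)
      ≈⟨ ^-sumFin-* a f (λ i → p ℕ.^ e i) ⟩
    ∏ (λ i → (a ^ (p ℕ.^ e i)) ^ f i)
      ≈⟨ ∏-cong (λ i → ^-congˡ (f i) (^-p≈⇒^-p^k≈ (fermat a) (e i))) ⟩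
    ∏ (λ i → a ^ f i)
      ≈⟨ ^-homo-sumFin a f ⟨
    a ^ sumFin f ∎

  ^≡ℤ^ : ∀ a m → a ^ m ≡ a ℤ.^ m
  ^≡ℤ^ a zero = ≡.refl
  ^≡ℤ^ a (suc m) = ≡.cong (a ℤ.*_) (^≡ℤ^ a m)


module DerangementCongruences {p : ℕ} (p-prime : Prime p) where

  open import Defs
  open import Data.Fin as Fin using (Fin)
  open import Data.Integer using (+_; 0ℤ)
  import Data.Nat as ℕ
  open import Data.Nat using (zero; suc; pred; NonZero)
  open import Data.Nat.Divisibility using (_∣_; divides; _∣0; ∣-refl; ∣m∣n⇒∣m+n; ∣m⇒∣m*n; ∣n⇒∣m*n)
  import Data.Nat.Properties as ℕₚ
  open import Data.Nat.Primality using (prime⇒nonZero)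
  open import Relation.Binary.PropositionalEquality as ≡ using (_≡_)
  open CoefficientwiseEquality using (coeffwise)
  open IntegerPolynomials using (monomial-+)
  open PolynomialsModulo p
  open IntegersModulo p using (_≡ₘ_; ≡⇒≡ₘ; +[m+n]≡ₘ+m)
  open DerangementRecurrence using (derangement-suc)
  open CommutativeRing ℤmod[x] hiding (zero)
  open import Algebra.Properties.CommutativeSemigroup *-commutativeSemigroup using (x∙yz≈y∙xz)
  open import Algebra.Properties.Semiring.Exp semiring
  open import Algebra.Properties.Semiring.Mult semiring using (_×_)
  open import Relation.Binary.Reasoning.Setoid setoid
  open Frobenius ℤmod[x]
  open Powers ℤmod[x]

  private
    instance
      p-nonZero : NonZero p
      p-nonZero = prime⇒nonZero p-prime

  const-≡ₘ : ∀ {a b} → a ≡ₘ b → const a ≈ const b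
  const-≡ₘ a≡b = coeffwise λ where
    zero → a≡b
    (suc i) → ≡⇒≡ₘ ≡.refl

  const-0ℤ≈0# : const 0ℤ ≈ 0#
  const-0ℤ≈0# = coeffwise λ where
    zero → ≡⇒≡ₘ ≡.refl
    (suc i) → ≡⇒≡ₘ ≡.refl

  n×1≈const : ∀ n → n × 1# ≈ const (+ n)
  n×1≈const zero = sym const-0ℤ≈0#
  n×1≈const (suc n) = +-congˡ (n×1≈const n)

  const-p≈0# : const (+ p) ≈ 0#
  const-p≈0# = trans (const-≡ₘ (+[m+n]≡ₘ+m 0)) const-0ℤ≈0#

  p×1≈0 : p × 1# ≈ 0#
  p×1≈0 = trans (n×1≈const p) const-p≈0#

  ^ᵖ≡^ : ∀ P m → P ^ᵖ m ≡ P ^ m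
  ^ᵖ≡^ P zero = ≡.refl
  ^ᵖ≡^ P (suc m) = ≡.cong (P ⊗_) (^ᵖ≡^ P m)

  prodFin≡∏ : ∀ {s} (f : Fin s → Poly) → prodFin f ≡ ∏ f
  prodFin≡∏ {zero} f = ≡.refl
  prodFin≡∏ {suc s} f = ≡.cong (f Fin.zero ⊗_) (prodFin≡∏ (λ i → f (Fin.suc i)))

  monomial1^m≈monomial : ∀ m → monomial 1 ^ m ≈ monomial m
  monomial1^m≈monomial zero = refl
  monomial1^m≈monomial (suc m) =
    trans (*-congˡ {monomial 1} (monomial1^m≈monomial m)) (≗ᶜ⇒≈ₘ (monomial-+ 1 m))

  x-1^p^k≈xpow-1[p^k] : ∀ k → x-1 ^ (p ℕ.^ k) ≈ xpow-1 (p ℕ.^ k)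
  x-1^p^k≈xpow-1[p^k] k = begin
    x-1 ^ (p ℕ.^ k)
      ≡⟨⟩
    (monomial 1 - 1#) ^ (p ℕ.^ k)
      ≈⟨ frobenius-iterate p-prime p×1≈0 k (monomial 1) (- 1#) ⟩
    monomial 1 ^ (p ℕ.^ k) + (- 1#) ^ (p ℕ.^ k)
      ≈⟨ +-cong (monomial1^m≈monomial (p ℕ.^ k)) (^-p≈⇒^-p^k≈ -1^p≈-1 k) ⟩
    monomial (p ℕ.^ k) - 1#
      ≡⟨⟩
    xpow-1 (p ℕ.^ k) ∎
    where
    -1^p≈-1 : (- 1#) ^ p ≈ - 1#
    -1^p≈-1 = trans (frobenius-neg p-prime p×1≈0 1#) (-‿cong (1#^n≈1# p))

  derangement-suc-≈ : ∀ n → derangement (suc n) ≈ x-1 ^ suc n + const (+ suc n) * derangement n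
  derangement-suc-≈ n = begin
    derangement (suc n)
      ≈⟨ ≗ᶜ⇒≈ₘ (derangement-suc n) ⟩
    x-1 ^ᵖ suc n + const (+ suc n) * derangement n
      ≡⟨ ≡.cong (λ P → P + const (+ suc n) * derangement n) (^ᵖ≡^ x-1 (suc n)) ⟩
    x-1 ^ suc n + const (+ suc n) * derangement n ∎

  derangement-p : derangement p ≈ x-1 ^ p
  derangement-p = begin
    derangement p
      ≡⟨ ≡.cong derangement (ℕₚ.suc-pred p) ⟨
    derangement (suc (pred p))
      ≈⟨ derangement-suc-≈ (pred p) ⟩
    x-1 ^ suc (pred p) + const (+ suc (pred p)) * D
      ≡⟨ ≡.cong (λ m → x-1 ^ m + const (+ m) * D) (ℕₚ.suc-pred p) ⟩
    x-1 ^ p + const (+ p) * D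
      ≈⟨ +-congˡ {x-1 ^ p} (trans (*-congʳ {D} const-p≈0#) (zeroˡ D)) ⟩
    x-1 ^ p + 0#
      ≈⟨ +-identityʳ (x-1 ^ p) ⟩
    x-1 ^ p ∎
    where
    D : Poly
    D = derangement (pred p)

  derangement-+p : ∀ n → derangement (n ℕ.+ p) ≈ x-1 ^ p * derangement n
  derangement-+p zero = trans derangement-p (sym (*-identityʳ _))
  derangement-+p (suc n) = begin
    derangement (suc (n ℕ.+ p))
      ≈⟨ derangement-suc-≈ (n ℕ.+ p) ⟩
    x-1 ^ suc (n ℕ.+ p) + const (+ (suc n ℕ.+ p)) * derangement (n ℕ.+ p)
      ≈⟨ +-cong (^-homo-* x-1 (suc n) p) (*-cong (const-≡ₘ (+[m+n]≡ₘ+m (suc n))) (derangement-+p n)) ⟩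
    x-1 ^ suc n * x-1 ^ p + const (+ suc n) * (x-1 ^ p * derangement n)
      ≈⟨ +-cong (*-comm (x-1 ^ suc n) (x-1 ^ p)) (x∙yz≈y∙xz (const (+ suc n)) (x-1 ^ p) (derangement n)) ⟩
    x-1 ^ p * x-1 ^ suc n + x-1 ^ p * (const (+ suc n) * derangement n)
      ≈⟨ distribˡ (x-1 ^ p) (x-1 ^ suc n) (const (+ suc n) * derangement n) ⟨
    x-1 ^ p * (x-1 ^ suc n + const (+ suc n) * derangement n)
      ≈⟨ *-congˡ {x-1 ^ p} (derangement-suc-≈ n) ⟨
    x-1 ^ p * derangement (suc n) ∎

  derangement-+-multiple : ∀ {K} → p ∣ K → ∀ n → derangement (K ℕ.+ n) ≈ x-1 ^ K * derangement n
  derangement-+-multiple (divides q ≡.refl) n = derangement-[q*p+n] q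
    where
    derangement-[q*p+n] : ∀ q → derangement (q ℕ.* p ℕ.+ n) ≈ x-1 ^ (q ℕ.* p) * derangement n
    derangement-[q*p+n] zero = sym (*-identityˡ _)
    derangement-[q*p+n] (suc q) = begin
      derangement (p ℕ.+ q ℕ.* p ℕ.+ n)
        ≡⟨ ≡.cong derangement (≡.trans (ℕₚ.+-assoc p (q ℕ.* p) n) (ℕₚ.+-comm p (q ℕ.* p ℕ.+ n))) ⟩
      derangement (q ℕ.* p ℕ.+ n ℕ.+ p)                ≈⟨ derangement-+p (q ℕ.* p ℕ.+ n) ⟩
      x-1 ^ p * derangement (q ℕ.* p ℕ.+ n)            ≈⟨ *-congˡ {x-1 ^ p} (derangement-[q*p+n] q) ⟩
      x-1 ^ p * (x-1 ^ (q ℕ.* p) * derangement n)      ≈⟨ *-assoc (x-1 ^ p) (x-1 ^ (q ℕ.* p)) (derangement n) ⟨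
      x-1 ^ p * x-1 ^ (q ℕ.* p) * derangement n        ≈⟨ *-congʳ {derangement n} (^-homo-* x-1 p (q ℕ.* p)) ⟨
      x-1 ^ (p ℕ.+ q ℕ.* p) * derangement n            ∎

  derangement-multiple : ∀ {K} → p ∣ K → derangement K ≈ x-1 ^ K
  derangement-multiple {K} p∣K = begin
    derangement K                    ≡⟨ ≡.cong derangement (ℕₚ.+-identityʳ K) ⟨
    derangement (K ℕ.+ 0)            ≈⟨ derangement-+-multiple p∣K 0 ⟩
    x-1 ^ K * 1#                     ≈⟨ *-identityʳ (x-1 ^ K) ⟩
    x-1 ^ K                          ∎

  x-1^sumFin≈prodFin : ∀ {s} (f e : Fin s → ℕ) →
    x-1 ^ sumFin (λ i → f i ℕ.* p ℕ.^ e i) ≈ prodFin (λ i → xpow-1 (p ℕ.^ e i) ^ᵖ f i)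
  x-1^sumFin≈prodFin f e = begin
    x-1 ^ sumFin (λ i → f i ℕ.* p ℕ.^ e i)
      ≈⟨ ^-sumFin-* x-1 f (λ i → p ℕ.^ e i) ⟩
    ∏ (λ i → (x-1 ^ (p ℕ.^ e i)) ^ f i)
      ≈⟨ ∏-cong (λ i → ^-congˡ (f i) (x-1^p^k≈xpow-1[p^k] (e i))) ⟩
    ∏ (λ i → xpow-1 (p ℕ.^ e i) ^ f i)
      ≈⟨ ∏-cong (λ i → reflexive (^ᵖ≡^ (xpow-1 (p ℕ.^ e i)) (f i))) ⟨
    ∏ (λ i → xpow-1 (p ℕ.^ e i) ^ᵖ f i)
      ≡⟨ prodFin≡∏ (λ i → xpow-1 (p ℕ.^ e i) ^ᵖ f i) ⟨
    prodFin (λ i → xpow-1 (p ℕ.^ e i) ^ᵖ f i) ∎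

  p∣sumFin-*p^[1+e] : ∀ {s} (f e : Fin s → ℕ) → p ∣ sumFin (λ i → f i ℕ.* p ℕ.^ suc (e i))
  p∣sumFin-*p^[1+e] {zero} f e = p ∣0
  p∣sumFin-*p^[1+e] {suc s} f e =
    ∣m∣n⇒∣m+n (∣n⇒∣m*n (f Fin.zero) (∣m⇒∣m*n (p ℕ.^ e Fin.zero) ∣-refl))
              (p∣sumFin-*p^[1+e] (λ i → f (Fin.suc i)) (λ i → e (Fin.suc i)))

  derangement-+-digits : ∀ n {s} (f e : Fin s → ℕ) →
    derangement (n ℕ.+ sumFin (λ i → f i ℕ.* p ℕ.^ suc (e i)))
      ≈ prodFin (λ i → xpow-1 (p ℕ.^ suc (e i)) ^ᵖ f i) * derangement n
  derangement-+-digits n f e = begin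
    derangement (n ℕ.+ K)       ≡⟨ ≡.cong derangement (ℕₚ.+-comm n K) ⟩
    derangement (K ℕ.+ n)       ≈⟨ derangement-+-multiple (p∣sumFin-*p^[1+e] f e) n ⟩
    x-1 ^ K * derangement n     ≈⟨ *-congʳ {derangement n} (x-1^sumFin≈prodFin f (λ i → suc (e i))) ⟩
    prodFin (λ i → xpow-1 (p ℕ.^ suc (e i)) ^ᵖ f i) * derangement n ∎
    where
    K : ℕ
    K = sumFin (λ i → f i ℕ.* p ℕ.^ suc (e i))


module EvaluationCongruence {p : ℕ} (p-prime : Prime p) where

  open import Defs
  open import Data.Fin using (Fin)
  open import Data.Integer as ℤ using (+_)
  import Data.Nat as ℕ
  open import Data.Nat using (suc)
  open import Relation.Binary.PropositionalEquality as ≡ using (_≡_)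
  open IntegersModulo p using (ℤmod)
  open PolynomialsModulo p using (ℤmod[x])
  open CommutativeRing ℤmod using (_≈_; setoid; semiring)
  open import Algebra.Properties.Semiring.Exp semiring using (_^_)
  open import Algebra.Properties.Semiring.Exp (CommutativeRing.semiring ℤmod[x]) using () renaming (_^_ to _^ₚ_)
  open import Relation.Binary.Reasoning.Setoid setoid
  open Evaluation
  open FermatLittleTheorem p-prime
  open DerangementCongruences p-prime using (^ᵖ≡^; derangement-multiple; p∣sumFin-*p^[1+e])

  eval-derangement-digits : ∀ {s} (f e : Fin s → ℕ) k →
    eval (derangement (sumFin (λ i → f i ℕ.* p ℕ.^ suc (e i)))) k ≈ (k ℤ.- + 1) ℤ.^ sumFin f
  eval-derangement-digits f e k = begin
    eval (derangement K) k      ≈⟨ eval-cong p k (derangement-multiple (p∣sumFin-*p^[1+e] f e)) ⟩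
    eval (x-1 ^ₚ K) k           ≡⟨ ≡.cong (λ P → eval P k) (^ᵖ≡^ x-1 K) ⟨
    eval (x-1 ^ᵖ K) k           ≡⟨ ≡.trans (eval-^ᵖ x-1 K k) (≡.cong (ℤ._^ K) (eval-x-1 k)) ⟩
    (k ℤ.- + 1) ℤ.^ K           ≡⟨ ^≡ℤ^ (k ℤ.- + 1) K ⟨
    (k ℤ.- + 1) ^ K             ≈⟨ ^-sumFin-*p^≈^-sumFin (k ℤ.- + 1) f (λ i → suc (e i)) ⟩
    (k ℤ.- + 1) ^ sumFin f      ≡⟨ ^≡ℤ^ (k ℤ.- + 1) (sumFin f) ⟩
    (k ℤ.- + 1) ℤ.^ sumFin f    ∎
    where
    K : ℕ
    K = sumFin (λ i → f i ℕ.* p ℕ.^ suc (e i))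


open import Defs
open import Data.Nat using (ℕ; suc; _*_; _^_; _≤_; _<_)
open import Data.Nat.Primality using (Prime)
open import Data.Fin using (Fin; toℕ; zero; suc)
open import Data.Integer using (ℤ; +_; _-_) renaming (_^_ to _^ℤ_)
open import Data.Product using (_×_)

open import Data.Integer.Divisibility.Signed using (∣⇒∣ᵤ)
import Data.Nat as ℕ
import Data.Nat.Properties as ℕₚ
open import Data.Product using (_,_)
open import Function using (_∘_)
open import Relation.Binary.PropositionalEquality using (cong)

corollary3 : (p : ℕ) → Prime p → 3 ≤ p → (s : ℕ) → 1 ≤ s →
  (m : Fin (suc s) → ℕ) → (∀ i → m i < p) →
  (derangement (sumFin (λ i → m i * p ^ toℕ i))
     ≡ₚ prodFin (λ (i : Fin s) → xpow-1 (p ^ suc (toℕ i)) ^ᵖ m (suc i)) ⊗ derangement (m zero) [mod p ])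
  × (derangement (sumFin (λ (i : Fin s) → m (suc i) * p ^ suc (toℕ i)))
     ≡ₚ prodFin (λ (i : Fin s) → xpow-1 (p ^ suc (toℕ i)) ^ᵖ m (suc i)) [mod p ])
  × ((k : ℤ) → eval (derangement (sumFin (λ (i : Fin s) → m (suc i) * p ^ suc (toℕ i)))) k
     ≡ᵢ (k - + 1) ^ℤ sumFin (λ (i : Fin s) → m (suc i)) [mod p ])
corollary3 p p-prime _ s _ m _ =
    ≈ₘ⇒≡ₚ (trans (reflexive (cong (λ n → derangement (n ℕ.+ K)) (ℕₚ.*-identityʳ (m zero))))
                 (derangement-+-digits (m zero) (m ∘ suc) toℕ))
  , ≈ₘ⇒≡ₚ (trans (derangement-+-digits 0 (m ∘ suc) toℕ) (*-identityʳ Π))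
  , λ k → ∣⇒∣ᵤ (n∣a-b (eval-derangement-digits p-prime (m ∘ suc) toℕ k))
  where
  K : ℕ
  K = sumFin (λ (i : Fin s) → m (suc i) * p ^ suc (toℕ i))
  Π : Poly
  Π = prodFin (λ (i : Fin s) → xpow-1 (p ^ suc (toℕ i)) ^ᵖ m (suc i))
  open PolynomialsModulo p using (≈ₘ⇒≡ₚ; ℤmod[x])
  open CommutativeRing ℤmod[x] using (trans; reflexive; *-identityʳ)
  open DerangementCongruences p-prime using (derangement-+-digits)
  open IntegersModulo p using (n∣a-b)
  open EvaluationCongruence using (eval-derangement-digits)
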